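{- Let $G$ be a group (written additively, identity $0$), $S$ a normal subset of $G$, and $C$ a subgroup of $G$, and suppose the Cayley sum graph $\mathrm{CS}(G,S)$ has degree $|S|$. Then $C$ is a total perfect code of $\mathrm{CS}(G,S)$ if and only if $G=C\oplus S$, i.e., every $g\in G$ can be written uniquely as $g=c+s$ with $c\in C$, $s\in S$.
   Context: A subset $S$ of $G$ is normal if $-g+S+g=S$ for all $g\in G$. The Cayley sum graph $\mathrm{CS}(G,S)$ has vertex set $G$, two vertices $g,h$ adjacent iff $g+h\in S$ and $g\neq h$. A total perfect code of a graph is a set $C$ of vertices such that every vertex has exactly one neighbor in $C$. For subsets $X,Y$ of $G$, $G=X\oplus Y$ means each $g\in G$ has a unique expression $g=x+y$ with $x\in X$, $y\in Y$. -}

module Defs where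

open import Level using (0ℓ)
open import Data.Nat using (ℕ)
open import Data.Fin using (Fin; _≟_)
open import Data.Fin.Subset using (Subset; _∈_; ∣_∣)
open import Data.Vec using (tabulate; lookup)
open import Data.Bool using (Bool; _∧_; not)
open import Data.Product using (_×_; ∃; ∃-syntax; _,_)
open import Relation.Nullary using (¬_; ⌊_⌋)
open import Relation.Binary.PropositionalEquality using (_≡_; _≢_)
open import Algebra.Core using (Op₁; Op₂)
open import Algebra.Structures using (IsGroup)
open import Function.Bundles using (_⇔_)

-- A finite group of order n, written additively, with carrier Fin n and
-- propositional equality.  Every finite group is isomorphic to one of these.
record FinGroup (n : ℕ) : Set where
  infixl 6 _+_
  infix 8 -_
  field
    _+_     : Op₂ (Fin n)
    0#      : Fin n
    -_      : Op₁ (Fin n)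
    isGroup : IsGroup _≡_ _+_ 0# -_

module _ {n : ℕ} (G : FinGroup n) where
  open FinGroup G

  IsNormal : Subset n → Set
  IsNormal S = ∀ g y → (y ∈ S ⇔ (∃[ s ] (s ∈ S × y ≡ (- g + s) + g)))

  IsSubgroup : Subset n → Set
  IsSubgroup C = (0# ∈ C)
               × (∀ x y → x ∈ C → y ∈ C → (x + y) ∈ C)
               × (∀ x → x ∈ C → (- x) ∈ C)

  Adj : Subset n → Fin n → Fin n → Set
  Adj S g h = ((g + h) ∈ S) × (g ≢ h)

  neighbours : Subset n → Fin n → Subset n
  neighbours S g = tabulate (λ h → lookup S (g + h) ∧ not ⌊ g ≟ h ⌋)

  degree : Subset n → Fin n → ℕ
  degree S g = ∣ neighbours S g ∣

  IsTotalPerfectCode : Subset n → Subset n → Set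
  IsTotalPerfectCode S C =
    ∀ g → ∃[ c ] ((c ∈ C × Adj S g c)
                  × (∀ c′ → c′ ∈ C → Adj S g c′ → c′ ≡ c))

  IsDirectSum : Subset n → Subset n → Set
  IsDirectSum C S =
    ∀ g → ∃[ c ] ∃[ s ] ((c ∈ C × s ∈ S × g ≡ c + s)
                  × (∀ c′ s′ → c′ ∈ C → s′ ∈ S → g ≡ c′ + s′ → (c′ ≡ c × s′ ≡ s)))

{-# OPTIONS --safe #-}
-- The candidate neighbours of g are the translate {h | g + h ∈ S}, which has |S|
-- elements; so degree |S| means g itself is never a candidate, i.e. g + g ∉ S, and
-- adjacency of g and c is just g + c ∈ S.  By normality g + c ∈ S ⟺ c + g ∈ S, and
-- since c ↦ -c permutes C, "exactly one c ∈ C adjacent to g" becomes "exactly one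
-- c ∈ C with -c + g ∈ S", which is the statement that g = c + s uniquely.
module Submission where

open import Defs
open import Level using (0ℓ)
open import Algebra.Bundles using (Group)
import Algebra.Properties.CommutativeMonoid.Sum as MonoidSum
import Algebra.Properties.Group as GroupProperties
open import Data.Bool using (Bool; true; false; _∧_; if_then_else_)
open import Data.Fin using (Fin; _≟_)
open import Data.Fin.Permutation using (Permutation; _⟨$⟩ʳ_; permutation)
open import Data.Fin.Subset using (Subset; _∈_; _∉_; _⊆_; ∣_∣)
open import Data.Fin.Subset.Properties using (p⊂q⇒∣p∣<∣q∣)
open import Data.Nat using (ℕ; suc)
open import Data.Nat.Properties using (+-0-commutativeMonoid; <-irrefl)
open import Data.Product using (∃-syntax; _×_; _,_; proj₁; proj₂)
open import Data.Vec using ([]; _∷_; tabulate; lookup)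
open import Data.Vec.Properties using ([]=⇒lookup; lookup⇒[]=; lookup∘tabulate)
open import Function.Base using (_∘_)
open import Function.Bundles using (_⇔_; mk⇔; Equivalence)
open import Function.Properties.Equivalence using () renaming (sym to ⇔-sym; trans to ⇔-trans)
open import Relation.Nullary using (yes; no)
open import Relation.Binary.PropositionalEquality
  using (_≡_; refl; sym; trans; cong; subst; module ≡-Reasoning)

open MonoidSum +-0-commutativeMonoid using (sum; sum-permute; sum-cong-≗)

indicator : Bool → ℕ
indicator b = if b then 1 else 0

∣p∣≡sum-indicator : ∀ {n} (p : Subset n) → ∣ p ∣ ≡ sum (indicator ∘ lookup p)
∣p∣≡sum-indicator []          = refl
∣p∣≡sum-indicator (true ∷ p)  = cong suc (∣p∣≡sum-indicator p)
∣p∣≡sum-indicator (false ∷ p) = ∣p∣≡sum-indicator p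

∣p∘π∣≡∣p∣ : ∀ {n} (p : Subset n) (π : Permutation n n) →
            ∣ tabulate (lookup p ∘ (π ⟨$⟩ʳ_)) ∣ ≡ ∣ p ∣
∣p∘π∣≡∣p∣ p π = begin
  ∣ p∘π ∣                                ≡⟨ ∣p∣≡sum-indicator p∘π ⟩
  sum (indicator ∘ lookup p∘π)           ≡⟨ sum-cong-≗ (cong indicator ∘ lookup∘tabulate (lookup p ∘ (π ⟨$⟩ʳ_))) ⟩
  sum (indicator ∘ lookup p ∘ (π ⟨$⟩ʳ_)) ≡⟨ sum-permute (indicator ∘ lookup p) π ⟨
  sum (indicator ∘ lookup p)             ≡⟨ ∣p∣≡sum-indicator p ⟨
  ∣ p ∣                                  ∎
  where
  open ≡-Reasoning
  p∘π : Subset _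
  p∘π = tabulate (lookup p ∘ (π ⟨$⟩ʳ_))

∈-tabulate⁺ : ∀ {n} {f : Fin n → Bool} {x} → f x ≡ true → x ∈ tabulate f
∈-tabulate⁺ {f = f} {x} fx≡true = lookup⇒[]= x (tabulate f) (trans (lookup∘tabulate f x) fx≡true)

∈-tabulate⁻ : ∀ {n} {f : Fin n → Bool} {x} → x ∈ tabulate f → f x ≡ true
∈-tabulate⁻ {f = f} {x} x∈f = trans (sym (lookup∘tabulate f x)) ([]=⇒lookup x∈f)

∧≡true⇒both : ∀ {a b} → a ∧ b ≡ true → a ≡ true × b ≡ true
∧≡true⇒both {true} {true} refl = refl , refl

∀-cong-⇔ : {A : Set} {P Q : A → Set} → (∀ x → P x ⇔ Q x) → (∀ x → P x) ⇔ (∀ x → Q x)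
∀-cong-⇔ P⇔Q = mk⇔ (λ p x → Equivalence.to (P⇔Q x) (p x)) (λ q x → Equivalence.from (P⇔Q x) (q x))

module _ {n : ℕ} where

  ExactlyOneIn : Subset n → (Fin n → Set) → Set
  ExactlyOneIn C P = ∃[ c ] ((c ∈ C × P c) × (∀ c′ → c′ ∈ C → P c′ → c′ ≡ c))

  ExactlyOneIn-map : {C : Subset n} {P Q : Fin n → Set} →
                     (∀ {x} → P x → Q x) → (∀ {x} → Q x → P x) →
                     ExactlyOneIn C P → ExactlyOneIn C Q
  ExactlyOneIn-map P⇒Q Q⇒P (c , (c∈C , Pc) , unique) =
    c , (c∈C , P⇒Q Pc) , λ c′ c′∈C Qc′ → unique c′ c′∈C (Q⇒P Qc′)

  ExactlyOneIn-cong : {C : Subset n} {P Q : Fin n → Set} →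
                      (∀ x → P x ⇔ Q x) → ExactlyOneIn C P ⇔ ExactlyOneIn C Q
  ExactlyOneIn-cong P⇔Q = mk⇔
    (ExactlyOneIn-map (Equivalence.to (P⇔Q _)) (Equivalence.from (P⇔Q _)))
    (ExactlyOneIn-map (Equivalence.from (P⇔Q _)) (Equivalence.to (P⇔Q _)))

  module _ {C : Subset n} {ι : Fin n → Fin n}
           (ι-involutive : ∀ x → ι (ι x) ≡ x) (ι-closed : ∀ {x} → x ∈ C → ι x ∈ C) where

    ExactlyOneIn-reindex : {P : Fin n → Set} → ExactlyOneIn C P → ExactlyOneIn C (P ∘ ι)
    ExactlyOneIn-reindex {P} (c , (c∈C , Pc) , unique) =
      ι c , (ι-closed c∈C , subst P (sym (ι-involutive c)) Pc) ,
      λ c′ c′∈C Pιc′ → trans (sym (ι-involutive c′)) (cong ι (unique (ι c′) (ι-closed c′∈C) Pιc′))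

    ExactlyOneIn-∘-involution : {P : Fin n → Set} → ExactlyOneIn C P ⇔ ExactlyOneIn C (P ∘ ι)
    ExactlyOneIn-∘-involution {P} = mk⇔ ExactlyOneIn-reindex
      (ExactlyOneIn-map (subst P (ι-involutive _)) (subst P (sym (ι-involutive _)))
       ∘ ExactlyOneIn-reindex)

module CayleySumGraph {n : ℕ} (G : FinGroup n) where
  open FinGroup G

  private
    group : Group 0ℓ 0ℓ
    group = record { _≈_ = _≡_ ; _∙_ = _+_ ; ε = 0# ; _⁻¹ = -_ ; isGroup = isGroup }

  open GroupProperties group public using (⁻¹-involutive; \\-leftDividesˡ; \\-leftDividesʳ)

  translate : Fin n → Subset n → Subset n
  translate g S = tabulate (λ h → lookup S (g + h))

  ∣translate∣≡∣S∣ : ∀ g S → ∣ translate g S ∣ ≡ ∣ S ∣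
  ∣translate∣≡∣S∣ g S =
    ∣p∘π∣≡∣p∣ S (permutation (g +_) (- g +_) (\\-leftDividesˡ g) (\\-leftDividesʳ g))

  neighbours⊆translate : ∀ S g → neighbours G S g ⊆ translate g S
  neighbours⊆translate S g x∈N = ∈-tabulate⁺ (proj₁ (∧≡true⇒both (∈-tabulate⁻ x∈N)))

  self∉neighbours : ∀ S g → g ∉ neighbours G S g
  self∉neighbours S g g∈N
    with g ≟ g | proj₂ (∧≡true⇒both {lookup S (g + g)} (∈-tabulate⁻ {x = g} g∈N))
  ... | yes _  | ()
  ... | no g≢g | _ = g≢g refl

  regular⇒loopless : ∀ S g → degree G S g ≡ ∣ S ∣ → g + g ∉ S
  regular⇒loopless S g deg≡ g+g∈S = <-irrefl (trans deg≡ (sym (∣translate∣≡∣S∣ g S)))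
    (p⊂q⇒∣p∣<∣q∣ (neighbours⊆translate S g , g , ∈-tabulate⁺ ([]=⇒lookup g+g∈S) , self∉neighbours S g))

  Adj⇔+∈ : ∀ {S g c} → g + g ∉ S → Adj G S g c ⇔ (g + c ∈ S)
  Adj⇔+∈ g+g∉S = mk⇔ proj₁ λ g+c∈S → g+c∈S , λ { refl → g+g∉S g+c∈S }

  normal⇒+∈-swap : ∀ {S} → IsNormal G S → ∀ {a b} → a + b ∈ S → b + a ∈ S
  normal⇒+∈-swap normal {a} {b} a+b∈S =
    Equivalence.from (normal a (b + a)) (a + b , a+b∈S , cong (_+ a) (sym (\\-leftDividesʳ a b)))

  normal⇒+∈-comm : ∀ {S} → IsNormal G S → ∀ {a b} → (a + b ∈ S) ⇔ (b + a ∈ S)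
  normal⇒+∈-comm normal = mk⇔ (normal⇒+∈-swap normal) (normal⇒+∈-swap normal)

  g≡c+s⇒s≡-c+g : ∀ {g c s} → g ≡ c + s → s ≡ - c + g
  g≡c+s⇒s≡-c+g {c = c} {s} refl = sym (\\-leftDividesʳ c s)

  IsDirectSum⇔ExactlyOneIn-quotient : ∀ C S → IsDirectSum G C S ⇔ (∀ g → ExactlyOneIn C (λ c → - c + g ∈ S))
  IsDirectSum⇔ExactlyOneIn-quotient C S = mk⇔ to from
    where
    to : IsDirectSum G C S → ∀ g → ExactlyOneIn C (λ c → - c + g ∈ S)
    to directSum g with directSum g
    ... | c , s , (c∈C , s∈S , g≡c+s) , unique =
      c , (c∈C , subst (_∈ S) (g≡c+s⇒s≡-c+g g≡c+s) s∈S) ,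
      λ c′ c′∈C s′∈S → proj₁ (unique c′ _ c′∈C s′∈S (sym (\\-leftDividesˡ c′ g)))

    from : (∀ g → ExactlyOneIn C (λ c → - c + g ∈ S)) → IsDirectSum G C S
    from exactlyOne g with exactlyOne g
    ... | c , (c∈C , s∈S) , unique =
      c , - c + g , (c∈C , s∈S , sym (\\-leftDividesˡ c g)) ,
      λ c′ s′ c′∈C s′∈S g≡c′+s′ →
        let s′≡-c′+g = g≡c+s⇒s≡-c+g g≡c′+s′
            c′≡c     = unique c′ c′∈C (subst (_∈ S) s′≡-c′+g s′∈S)
        in c′≡c , trans s′≡-c′+g (cong (λ x → - x + g) c′≡c)

lemma2p1 : (n : ℕ) (G : FinGroup n) (S C : Subset n)
           → IsNormal G S → IsSubgroup G C
           → (∀ g → degree G S g ≡ ∣ S ∣)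
           → (IsTotalPerfectCode G S C ⇔ IsDirectSum G C S)
lemma2p1 n G S C normal (_ , _ , C-closed-neg) regular =
  ⇔-trans (∀-cong-⇔ codeAt⇔quotientAt) (⇔-sym (IsDirectSum⇔ExactlyOneIn-quotient C S))
  where
  open FinGroup G
  open CayleySumGraph G

  codeAt⇔quotientAt : ∀ g → ExactlyOneIn C (Adj G S g) ⇔ ExactlyOneIn C (λ c → - c + g ∈ S)
  codeAt⇔quotientAt g = ⇔-trans
    (ExactlyOneIn-cong λ c → ⇔-trans (Adj⇔+∈ (regular⇒loopless S g (regular g))) (normal⇒+∈-comm normal))
    (ExactlyOneIn-∘-involution ⁻¹-involutive (C-closed-neg _))
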